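{- Let $\mathbf{M}_n$ be the $2n\times n$ matrix obtained by stacking vertically the inverse $\mathbf{A}_n^{ -1}$ of the Cartan matrix of type $A_n$ on top of the identity matrix $\mathbf{I}_n$. Then every maximal minor of $\mathbf{M}_n$ is either $0$ or of the form $k/(n+1)$ where $k$ is an integer dividing $(n+1)!$.
   Context: The Cartan matrix $\mathbf{A}_n$ of type $A_n$ is the $n\times n$ matrix with entries $2$ on the diagonal, $-1$ in positions $(i,i+1)$ and $(i+1,i)$, and $0$ elsewhere. A maximal minor of a $2n\times n$ matrix is the determinant of an $n\times n$ submatrix formed by choosing $n$ of its rows. -}

module Defs where

open import Data.Nat as ℕ using (ℕ; zero; suc)
open import Data.Nat using (_!)
open import Data.Fin as Fin using (Fin; zero; suc; toℕ; punchIn; splitAt)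
open import Data.Sum using (_⊎_; inj₁; inj₂)
open import Data.Product using (Σ; ∃; _×_; _,_)
open import Data.Integer as ℤ using (ℤ; +_)
open import Data.Integer.Divisibility as ℤD using ()
open import Data.Rational as ℚ using (ℚ; 0ℚ; 1ℚ; _+_; _*_; -_)
open import Relation.Binary.PropositionalEquality using (_≡_)
open import Relation.Nullary using (yes; no)

Mat : ℕ → ℕ → Set
Mat m n = Fin m → Fin n → ℚ

Σᶠ : (n : ℕ) → (Fin n → ℚ) → ℚ
Σᶠ zero    f = 0ℚ
Σᶠ (suc n) f = f zero + Σᶠ n (λ i → f (suc i))

_·_ : ∀ {m n p} → Mat m n → Mat n p → Mat m p
_·_ {n = n} A B i k = Σᶠ n (λ j → A i j * B j k)

identity : (n : ℕ) → Mat n n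
identity n i j with i Fin.≟ j
... | yes _ = 1ℚ
... | no  _ = 0ℚ

sgn : ℕ → ℚ
sgn zero          = 1ℚ
sgn (suc zero)    = - 1ℚ
sgn (suc (suc k)) = sgn k

det : (n : ℕ) → Mat n n → ℚ
det zero    M = 1ℚ
det (suc n) M =
  Σᶠ (suc n) (λ j → sgn (toℕ j) * (M zero j * det n (λ r c → M (suc r) (punchIn j c))))

cartanA : (n : ℕ) → Mat n n
cartanA n i j with toℕ i ℕ.≟ toℕ j | suc (toℕ i) ℕ.≟ toℕ j | toℕ i ℕ.≟ suc (toℕ j)
... | yes _ | _     | _     = (+ 2 ℚ./ 1)
... | no  _ | yes _ | _     = - 1ℚ
... | no  _ | no  _ | yes _ = - 1ℚ
... | no  _ | no  _ | no  _ = 0ℚ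

IsInverse : ∀ {n} → Mat n n → Mat n n → Set
IsInverse {n} A B = (A · B ≡ identity n) × (B · A ≡ identity n)

stack : ∀ {n} → Mat n n → Mat n n → Mat (n ℕ.+ n) n
stack {n} T Bot r c with splitAt n r
... | inj₁ i = T i c
... | inj₂ i = Bot i c

RowChoice : ℕ → ℕ → Set
RowChoice k m = Σ (Fin k → Fin m) (λ f → ∀ i j → i Fin.< j → f i Fin.< f j)

minor : ∀ {m n} → Mat m n → RowChoice n m → ℚ
minor {n = n} M (f , _) = det n (λ r c → M (f r) c)

-- Let X be the chosen n × n submatrix of [A⁻¹ ; I]. The rows of X · A are the corresponding
-- rows of [I ; A], and det (X · A) = (n + 1) · det X. As det is given by Laplace expansion,
-- the latter comes from column operations: X · A and X both turn into the matrix with columns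
-- (k + 2) xₖ − (k + 1) xₖ₊₁, which multiplies the determinant by n! and by (n + 1)! respectively.
--
-- Expanding along its identity rows turns a minor of [I ; A] into ± a minor of the tridiagonal
-- matrix A with increasing row and column indices. Such a minor is 0 or ± the product of the
-- continuants ℓ + 1 of its maximal runs of ℓ consecutive diagonal entries. The runs are
-- separated, so these factors sum to at most n + 1 and their product divides (n + 1)!.

{-# OPTIONS --safe #-}
module Submission where

open import Defs
open import Data.Nat as ℕ using (ℕ; suc; _≤_)
open import Data.Nat using (_!)
open import Data.Product using (∃; _×_)
open import Data.Sum using (_⊎_)
open import Data.Integer as ℤ using (ℤ; +_)
open import Data.Integer.Divisibility using (_∣_)
open import Data.Rational as ℚ using (ℚ; 0ℚ; _/_)
open import Relation.Binary.PropositionalEquality using (_≡_)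

open import Data.Nat using (zero; _<_; _∸_; _⊔_; s≤s; z≤n)
import Data.Nat.Properties as ℕP
import Data.Nat.Divisibility as ℕD
open import Data.Nat.Combinatorics using (k![n∸k]!∣n!)
open import Data.Fin as Fin using (Fin; zero; suc; toℕ; punchIn; punchOut; inject₁; fromℕ<; splitAt)
import Data.Fin.Properties as FinP
open FinP using (punchIn-punchOut; punchIn-injective; punchInᵢ≢i)
open import Data.Integer using (-[1+_])
import Data.Integer.Tactic.RingSolver as ℤ-Solver
open import Data.Rational using (1ℚ; _+_; _*_; -_; _-_; toℚᵘ)
import Data.Rational.Properties as ℚP
open import Data.Rational.Unnormalised as ℚᵘ using (mkℚᵘ; *≡*; _≃_)
import Data.Rational.Unnormalised.Properties as ℚᵘP
open import Data.Product using (Σ; _,_)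
open import Data.Sum using (inj₁; inj₂)
open import Data.Empty using (⊥-elim)
open import Function using (_∘_)
open import Level using (0ℓ)
open import Relation.Binary using (tri<; tri≈; tri>)
open import Relation.Binary.PropositionalEquality
  using (_≢_; refl; sym; trans; cong; cong₂; subst; subst₂; module ≡-Reasoning)
open import Relation.Nullary using (¬_; Dec; yes; no)
open import Relation.Nullary.Decidable using (dec⇒maybe)
open import Tactic.RingSolver using (solve-∀)
import Tactic.RingSolver.Core.AlmostCommutativeRing as ACR

ℚ-ring : ACR.AlmostCommutativeRing 0ℓ 0ℓ
ℚ-ring = ACR.fromCommutativeRing ℚP.+-*-commutativeRing (λ x → dec⇒maybe (0ℚ ℚ.≟ x))

-1*x≡-x : ∀ x → - 1ℚ * x ≡ - x
-1*x≡-x = solve-∀ ℚ-ring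

x*-y≡-[x*y] : ∀ x y → x * - y ≡ - (x * y)
x*-y≡-[x*y] = solve-∀ ℚ-ring

-- Determinants by Laplace expansion

Σᶠ-cong : ∀ n {f g : Fin n → ℚ} → (∀ i → f i ≡ g i) → Σᶠ n f ≡ Σᶠ n g
Σᶠ-cong zero    f≗g = refl
Σᶠ-cong (suc n) f≗g = cong₂ _+_ (f≗g zero) (Σᶠ-cong n (λ i → f≗g (suc i)))

Σᶠ-zero : ∀ n {f : Fin n → ℚ} → (∀ i → f i ≡ 0ℚ) → Σᶠ n f ≡ 0ℚ
Σᶠ-zero n f≗0 = trans (Σᶠ-cong n f≗0) (Σᶠ-const0 n)
  where
  Σᶠ-const0 : ∀ n → Σᶠ n (λ _ → 0ℚ) ≡ 0ℚ
  Σᶠ-const0 zero    = refl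
  Σᶠ-const0 (suc n) = cong (_+_ 0ℚ) (Σᶠ-const0 n)

Σᶠ-+ : ∀ n (f g : Fin n → ℚ) → Σᶠ n (λ i → f i + g i) ≡ Σᶠ n f + Σᶠ n g
Σᶠ-+ zero    f g = refl
Σᶠ-+ (suc n) f g =
  trans (cong (_+_ (f zero + g zero)) (Σᶠ-+ n (λ i → f (suc i)) (λ i → g (suc i))))
        (interchange (f zero) (g zero) _ _)
  where
  interchange : ∀ a b c d → (a + b) + (c + d) ≡ (a + c) + (b + d)
  interchange = solve-∀ ℚ-ring

Σᶠ-*ˡ : ∀ n a (f : Fin n → ℚ) → Σᶠ n (λ i → a * f i) ≡ a * Σᶠ n f
Σᶠ-*ˡ zero    a f = sym (ℚP.*-zeroʳ a)
Σᶠ-*ˡ (suc n) a f =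
  trans (cong (_+_ (a * f zero)) (Σᶠ-*ˡ n a (λ i → f (suc i)))) (sym (ℚP.*-distribˡ-+ a _ _))

Σᶠ-single : ∀ n (f : Fin n → ℚ) k → (∀ i → i ≢ k → f i ≡ 0ℚ) → Σᶠ n f ≡ f k
Σᶠ-single (suc n) f zero    f≡0 =
  trans (cong (_+_ (f zero)) (Σᶠ-zero n (λ i → f≡0 (suc i) λ ()))) (ℚP.+-identityʳ _)
Σᶠ-single (suc n) f (suc k) f≡0 =
  trans (cong₂ _+_ (f≡0 zero λ ()) (Σᶠ-single n (λ i → f (suc i)) k λ i i≢k → f≡0 (suc i) (i≢k ∘ FinP.suc-injective)))
        (ℚP.+-identityˡ _)

Σᶠ-adjacentPair : ∀ n (f : Fin (suc n) → ℚ) c → (∀ i → i ≢ inject₁ c → i ≢ suc c → f i ≡ 0ℚ) →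
                  Σᶠ (suc n) f ≡ f (inject₁ c) + f (suc c)
Σᶠ-adjacentPair (suc n) f zero    f≡0 =
  trans (cong (λ x → f zero + (f (suc zero) + x)) (Σᶠ-zero n (λ i → f≡0 (suc (suc i)) (λ ()) (λ ()))))
        (cong (_+_ (f zero)) (ℚP.+-identityʳ _))
Σᶠ-adjacentPair (suc n) f (suc c) f≡0 =
  trans (cong (_+ Σᶠ (suc n) (λ i → f (suc i))) (f≡0 zero (λ ()) (λ ())))
        (trans (ℚP.+-identityˡ _)
               (Σᶠ-adjacentPair n (λ i → f (suc i)) c
                  (λ i i≢c i≢sc → f≡0 (suc i) (i≢c ∘ FinP.suc-injective) (i≢sc ∘ FinP.suc-injective))))

minorAt : ∀ {n} → Mat (suc n) (suc n) → Fin (suc n) → Mat n n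
minorAt M j r c = M (suc r) (punchIn j c)

laplaceTerm : ∀ {n} → Mat (suc n) (suc n) → Fin (suc n) → ℚ
laplaceTerm {n} M j = sgn (toℕ j) * (M zero j * det n (minorAt M j))

laplaceTerm-zeroEntry : ∀ {n} (M : Mat (suc n) (suc n)) j → M zero j ≡ 0ℚ → laplaceTerm M j ≡ 0ℚ
laplaceTerm-zeroEntry {n} M j M₀ⱼ≡0 = begin
  sgn (toℕ j) * (M zero j * det n (minorAt M j)) ≡⟨ cong (λ x → sgn (toℕ j) * (x * det n (minorAt M j))) M₀ⱼ≡0 ⟩
  sgn (toℕ j) * (0ℚ * det n (minorAt M j))       ≡⟨ cong (sgn (toℕ j) *_) (ℚP.*-zeroˡ (det n (minorAt M j))) ⟩
  sgn (toℕ j) * 0ℚ                               ≡⟨ ℚP.*-zeroʳ (sgn (toℕ j)) ⟩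
  0ℚ                                             ∎
  where open ≡-Reasoning

laplaceTerm-zeroMinor : ∀ {n} (M : Mat (suc n) (suc n)) j → det n (minorAt M j) ≡ 0ℚ → laplaceTerm M j ≡ 0ℚ
laplaceTerm-zeroMinor {n} M j minor≡0 =
  trans (cong (λ d → sgn (toℕ j) * (M zero j * d)) minor≡0)
        (trans (cong (sgn (toℕ j) *_) (ℚP.*-zeroʳ (M zero j))) (ℚP.*-zeroʳ (sgn (toℕ j))))

det-cong : ∀ n {M N : Mat n n} → (∀ r c → M r c ≡ N r c) → det n M ≡ det n N
det-cong zero    M≗N = refl
det-cong (suc n) M≗N = Σᶠ-cong (suc n) λ j →
  cong (sgn (toℕ j) *_) (cong₂ _*_ (M≗N zero j) (det-cong n (λ r c → M≗N (suc r) (punchIn j c))))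

det-firstRowSingle : ∀ n (M : Mat (suc n) (suc n)) k → (∀ j → j ≢ k → M zero j ≡ 0ℚ) →
                     det (suc n) M ≡ laplaceTerm M k
det-firstRowSingle n M k M₀ⱼ≡0 = Σᶠ-single (suc n) (laplaceTerm M) k (λ j j≢k → laplaceTerm-zeroEntry M j (M₀ⱼ≡0 j j≢k))

det-firstRowHead : ∀ n (M : Mat (suc n) (suc n)) → (∀ j → j ≢ zero → M zero j ≡ 0ℚ) →
                   det (suc n) M ≡ M zero zero * det n (minorAt M zero)
det-firstRowHead n M M₀ⱼ≡0 = trans (det-firstRowSingle n M zero M₀ⱼ≡0) (ℚP.*-identityˡ _)

det-firstRowZero : ∀ n (M : Mat (suc n) (suc n)) → (∀ j → M zero j ≡ 0ℚ) → det (suc n) M ≡ 0ℚ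
det-firstRowZero n M M₀ⱼ≡0 = Σᶠ-zero (suc n) (λ j → laplaceTerm-zeroEntry M j (M₀ⱼ≡0 j))

punchIn≢ : ∀ {n} {j c : Fin (suc n)} (j≢c : j ≢ c) {k} → k ≢ punchOut j≢c → punchIn j k ≢ c
punchIn≢ {j = j} j≢c {k} k≢c′ pⱼk≡c =
  k≢c′ (punchIn-injective j k (punchOut j≢c) (trans pⱼk≡c (sym (punchIn-punchOut j≢c))))

det-linearCol : ∀ n (M P Q : Mat n n) c a b →
                (∀ r → M r c ≡ a * P r c + b * Q r c) →
                (∀ r k → k ≢ c → M r k ≡ P r k) →
                (∀ r k → k ≢ c → M r k ≡ Q r k) →
                det n M ≡ a * det n P + b * det n Q
det-linearCol (suc n) M P Q c a b M≡aP+bQ M≡P M≡Q = begin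
  Σᶠ (suc n) (laplaceTerm M)
    ≡⟨ Σᶠ-cong (suc n) termwise ⟩
  Σᶠ (suc n) (λ j → a * laplaceTerm P j + b * laplaceTerm Q j)
    ≡⟨ Σᶠ-+ (suc n) (λ j → a * laplaceTerm P j) (λ j → b * laplaceTerm Q j) ⟩
  Σᶠ (suc n) (λ j → a * laplaceTerm P j) + Σᶠ (suc n) (λ j → b * laplaceTerm Q j)
    ≡⟨ cong₂ _+_ (Σᶠ-*ˡ (suc n) a (laplaceTerm P)) (Σᶠ-*ˡ (suc n) b (laplaceTerm Q)) ⟩
  a * det (suc n) P + b * det (suc n) Q
    ∎
  where
  open ≡-Reasoning
  distribˡ : ∀ a b s x y d → s * ((a * x + b * y) * d) ≡ a * (s * (x * d)) + b * (s * (y * d))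
  distribˡ = solve-∀ ℚ-ring
  distribʳ : ∀ a b s x d e → s * (x * (a * d + b * e)) ≡ a * (s * (x * d)) + b * (s * (x * e))
  distribʳ = solve-∀ ℚ-ring

  termwise : ∀ j → laplaceTerm M j ≡ a * laplaceTerm P j + b * laplaceTerm Q j
  termwise j with j Fin.≟ c
  ... | yes refl = begin
    s * (M zero j * det n (minorAt M j))
      ≡⟨ cong (λ x → s * (x * det n (minorAt M j))) (M≡aP+bQ zero) ⟩
    s * ((a * P zero j + b * Q zero j) * det n (minorAt M j))
      ≡⟨ distribˡ a b s (P zero j) (Q zero j) (det n (minorAt M j)) ⟩
    a * (s * (P zero j * det n (minorAt M j))) + b * (s * (Q zero j * det n (minorAt M j)))
      ≡⟨ cong₂ (λ d e → a * (s * (P zero j * d)) + b * (s * (Q zero j * e)))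
               (det-cong n λ r k → M≡P (suc r) (punchIn j k) (punchInᵢ≢i j k))
               (det-cong n λ r k → M≡Q (suc r) (punchIn j k) (punchInᵢ≢i j k)) ⟩
    a * laplaceTerm P j + b * laplaceTerm Q j
      ∎
    where s = sgn (toℕ j)
  ... | no j≢c = begin
    s * (M zero j * det n (minorAt M j))
      ≡⟨ cong (λ d → s * (M zero j * d)) minor-linear ⟩
    s * (M zero j * (a * det n (minorAt P j) + b * det n (minorAt Q j)))
      ≡⟨ distribʳ a b s (M zero j) (det n (minorAt P j)) (det n (minorAt Q j)) ⟩
    a * (s * (M zero j * det n (minorAt P j))) + b * (s * (M zero j * det n (minorAt Q j)))
      ≡⟨ cong₂ (λ x y → a * (s * (x * det n (minorAt P j))) + b * (s * (y * det n (minorAt Q j))))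
               (M≡P zero j j≢c) (M≡Q zero j j≢c) ⟩
    a * laplaceTerm P j + b * laplaceTerm Q j
      ∎
    where
    s = sgn (toℕ j)
    c′ = punchOut j≢c
    minor-linear : det n (minorAt M j) ≡ a * det n (minorAt P j) + b * det n (minorAt Q j)
    minor-linear = det-linearCol n (minorAt M j) (minorAt P j) (minorAt Q j) c′ a b
      (λ r → subst (λ k → M (suc r) k ≡ a * P (suc r) k + b * Q (suc r) k)
                   (sym (punchIn-punchOut j≢c)) (M≡aP+bQ (suc r)))
      (λ r k k≢c′ → M≡P (suc r) (punchIn j k) (punchIn≢ j≢c k≢c′))
      (λ r k k≢c′ → M≡Q (suc r) (punchIn j k) (punchIn≢ j≢c k≢c′))

sgn-suc : ∀ k → sgn (suc k) ≡ - sgn k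
sgn-suc zero          = refl
sgn-suc (suc zero)    = refl
sgn-suc (suc (suc k)) = sgn-suc k

punchIn-inject₁-suc : ∀ {n} (c k : Fin n) →
  punchIn (inject₁ c) k ≡ punchIn (suc c) k ⊎ (punchIn (inject₁ c) k ≡ suc c × punchIn (suc c) k ≡ inject₁ c)
punchIn-inject₁-suc zero    zero    = inj₂ (refl , refl)
punchIn-inject₁-suc zero    (suc k) = inj₁ refl
punchIn-inject₁-suc (suc c) zero    = inj₁ refl
punchIn-inject₁-suc (suc c) (suc k) with punchIn-inject₁-suc c k
... | inj₁ eq          = inj₁ (cong suc eq)
... | inj₂ (eq₁ , eq₂) = inj₂ (cong suc eq₁ , cong suc eq₂)

punchIn-adjacent : ∀ {n} (j : Fin (suc (suc n))) (c : Fin (suc n)) → j ≢ inject₁ c → j ≢ suc c →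
                   Σ (Fin n) λ c′ → punchIn j (inject₁ c′) ≡ inject₁ c × punchIn j (suc c′) ≡ suc c
punchIn-adjacent zero          zero    j≢c _    = ⊥-elim (j≢c refl)
punchIn-adjacent zero          (suc c) _   _    = c , refl , refl
punchIn-adjacent (suc zero)    zero    _   j≢sc = ⊥-elim (j≢sc refl)
punchIn-adjacent {suc n} (suc (suc j)) zero _ _ = zero , refl , refl
punchIn-adjacent {suc n} (suc j) (suc c) j≢c j≢sc
  with punchIn-adjacent j c (j≢c ∘ cong suc) (j≢sc ∘ cong suc)
... | c′ , eq₁ , eq₂ = suc c′ , cong suc eq₁ , cong suc eq₂

-- The Laplace terms at the two equal columns cancel, and every other minor again has two equal
-- adjacent columns.
det-adjacentEqualCols : ∀ n (M : Mat (suc n) (suc n)) c → (∀ r → M r (inject₁ c) ≡ M r (suc c)) →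
                        det (suc n) M ≡ 0ℚ
det-adjacentEqualCols (suc n) M c Mc≡Mc+1 = begin
  Σᶠ (suc (suc n)) (laplaceTerm M)
    ≡⟨ Σᶠ-adjacentPair (suc n) (laplaceTerm M) c other-terms ⟩
  sgn (toℕ (inject₁ c)) * (M zero (inject₁ c) * det (suc n) (minorAt M (inject₁ c))) + laplaceTerm M (suc c)
    ≡⟨ cong₂ (λ k x → sgn k * (x * det (suc n) (minorAt M (inject₁ c))) + laplaceTerm M (suc c))
             (FinP.toℕ-inject₁ c) (Mc≡Mc+1 zero) ⟩
  sgn (toℕ c) * (M zero (suc c) * det (suc n) (minorAt M (inject₁ c))) + laplaceTerm M (suc c)
    ≡⟨ cong₂ (λ d s → sgn (toℕ c) * (M zero (suc c) * d) + s * (M zero (suc c) * det (suc n) (minorAt M (suc c))))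
             (det-cong (suc n) equal-minors) (sgn-suc (toℕ c)) ⟩
  sgn (toℕ c) * (M zero (suc c) * det (suc n) (minorAt M (suc c)))
    + - sgn (toℕ c) * (M zero (suc c) * det (suc n) (minorAt M (suc c)))
    ≡⟨ cancel (sgn (toℕ c)) (M zero (suc c) * det (suc n) (minorAt M (suc c))) ⟩
  0ℚ
    ∎
  where
  open ≡-Reasoning
  cancel : ∀ s x → s * x + - s * x ≡ 0ℚ
  cancel = solve-∀ ℚ-ring

  other-terms : ∀ j → j ≢ inject₁ c → j ≢ suc c → laplaceTerm M j ≡ 0ℚ
  other-terms j j≢c j≢sc with punchIn-adjacent j c j≢c j≢sc
  ... | c′ , eq₁ , eq₂ = laplaceTerm-zeroMinor M j (det-adjacentEqualCols n (minorAt M j) c′ λ r →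
    trans (cong (M (suc r)) eq₁) (trans (Mc≡Mc+1 (suc r)) (cong (M (suc r)) (sym eq₂))))

  equal-minors : ∀ r k → minorAt M (inject₁ c) r k ≡ minorAt M (suc c) r k
  equal-minors r k with punchIn-inject₁-suc c k
  ... | inj₁ eq          = cong (M (suc r)) eq
  ... | inj₂ (eq₁ , eq₂) =
    trans (cong (M (suc r)) eq₁) (trans (sym (Mc≡Mc+1 (suc r))) (cong (M (suc r)) (sym eq₂)))

Adjacent : ∀ {n} → Fin n → Fin n → Set
Adjacent p q = toℕ q ≡ suc (toℕ p) ⊎ toℕ p ≡ suc (toℕ q)

toℕ-suc⇒inject₁-suc : ∀ {n} (p q : Fin (suc n)) → toℕ q ≡ suc (toℕ p) →
                     Σ (Fin n) λ c → p ≡ inject₁ c × q ≡ suc c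
toℕ-suc⇒inject₁-suc {suc n} zero    (suc zero) refl = zero , refl , refl
toℕ-suc⇒inject₁-suc {suc n} (suc p) (suc q)    eq with toℕ-suc⇒inject₁-suc p q (ℕP.suc-injective eq)
... | c , eq₁ , eq₂ = suc c , cong suc eq₁ , cong suc eq₂

replaceCol : ∀ {n} → Mat n n → Fin n → Fin n → Mat n n
replaceCol M p q r k with k Fin.≟ p
... | yes _ = M r q
... | no  _ = M r k

replaceCol-at : ∀ {n} (M : Mat n n) p q r → replaceCol M p q r p ≡ M r q
replaceCol-at M p q r with p Fin.≟ p
... | yes _   = refl
... | no  p≢p = ⊥-elim (p≢p refl)

replaceCol-off : ∀ {n} (M : Mat n n) p q r k → k ≢ p → replaceCol M p q r k ≡ M r k
replaceCol-off M p q r k k≢p with k Fin.≟ p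
... | yes k≡p = ⊥-elim (k≢p k≡p)
... | no  _   = refl

inject₁≢suc : ∀ {n} (c : Fin n) → inject₁ c ≢ suc c
inject₁≢suc zero    ()
inject₁≢suc (suc c) eq = inject₁≢suc c (FinP.suc-injective eq)

det-replaceCol-adjacent : ∀ n (M : Mat n n) p q → Adjacent p q → det n (replaceCol M p q) ≡ 0ℚ
det-replaceCol-adjacent (suc n) M p q (inj₁ q≡p+1) with toℕ-suc⇒inject₁-suc p q q≡p+1
... | c , refl , refl = det-adjacentEqualCols n (replaceCol M p q) c λ r →
  trans (replaceCol-at M p q r) (sym (replaceCol-off M p q r q (inject₁≢suc c ∘ sym)))
det-replaceCol-adjacent (suc n) M p q (inj₂ p≡q+1) with toℕ-suc⇒inject₁-suc q p p≡q+1
... | c , refl , refl = det-adjacentEqualCols n (replaceCol M p q) c λ r →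
  trans (replaceCol-off M p q r q (inject₁≢suc c)) (sym (replaceCol-at M p q r))

det-addAdjacentCol : ∀ n (M M′ : Mat n n) p q a b → Adjacent p q →
                     (∀ r → M′ r p ≡ a * M r p + b * M r q) → (∀ r k → k ≢ p → M′ r k ≡ M r k) →
                     det n M′ ≡ a * det n M
det-addAdjacentCol n M M′ p q a b p~q M′p M′k = begin
  det n M′
    ≡⟨ det-linearCol n M′ M (replaceCol M p q) p a b
         (λ r → trans (M′p r) (cong (λ x → a * M r p + b * x) (sym (replaceCol-at M p q r))))
         M′k
         (λ r k k≢p → trans (M′k r k k≢p) (sym (replaceCol-off M p q r k k≢p))) ⟩
  a * det n M + b * det n (replaceCol M p q)
    ≡⟨ cong (λ d → a * det n M + b * d) (det-replaceCol-adjacent n M p q p~q) ⟩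
  a * det n M + b * 0ℚ
    ≡⟨ trans (cong (_+_ (a * det n M)) (ℚP.*-zeroʳ b)) (ℚP.+-identityʳ _) ⟩
  a * det n M
    ∎
  where open ≡-Reasoning

det-scaleCol : ∀ n (M M′ : Mat n n) p a → (∀ r → M′ r p ≡ a * M r p) → (∀ r k → k ≢ p → M′ r k ≡ M r k) →
               det n M′ ≡ a * det n M
det-scaleCol n M M′ p a M′p M′k = begin
  det n M′                    ≡⟨ det-linearCol n M′ M M p a 0ℚ (λ r → trans (M′p r) (sym (+0 (a * M r p) (M r p)))) M′k M′k ⟩
  a * det n M + 0ℚ * det n M  ≡⟨ +0 (a * det n M) (det n M) ⟩
  a * det n M                 ∎
  where
  open ≡-Reasoning
  +0 : ∀ x y → x + 0ℚ * y ≡ x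
  +0 = solve-∀ ℚ-ring

det-zeroCol : ∀ n (M : Mat n n) p → (∀ r → M r p ≡ 0ℚ) → det n M ≡ 0ℚ
det-zeroCol n M p Mp≡0 =
  trans (det-scaleCol n M M p 0ℚ (λ r → trans (Mp≡0 r) (sym (ℚP.*-zeroˡ (M r p)))) (λ _ _ _ → refl))
        (ℚP.*-zeroˡ (det n M))

det-firstColHead : ∀ n (M : Mat (suc n) (suc n)) → (∀ r → M (suc r) zero ≡ 0ℚ) →
                   det (suc n) M ≡ M zero zero * det n (minorAt M zero)
det-firstColHead n M Mr0≡0 = trans (Σᶠ-single (suc n) (laplaceTerm M) zero (other-terms n M Mr0≡0)) (ℚP.*-identityˡ _)
  where
  other-terms : ∀ n (M : Mat (suc n) (suc n)) → (∀ r → M (suc r) zero ≡ 0ℚ) → ∀ j → j ≢ zero → laplaceTerm M j ≡ 0ℚ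
  other-terms _       _ _     zero    j≢0 = ⊥-elim (j≢0 refl)
  other-terms (suc n) M Mr0≡0 (suc j) _   =
    laplaceTerm-zeroMinor M (suc j) (det-zeroCol (suc n) (minorAt M (suc j)) zero Mr0≡0)

det-tridiagonalHead : ∀ n (M : Mat (suc (suc n)) (suc (suc n))) →
                      (∀ c → M zero (suc (suc c)) ≡ 0ℚ) → (∀ r → M (suc (suc r)) zero ≡ 0ℚ) →
                      det (suc (suc n)) M ≡ M zero zero * det (suc n) (minorAt M zero)
                                           - M zero (suc zero) * (M (suc zero) zero * det n (λ r c → M (suc (suc r)) (suc (suc c))))
det-tridiagonalHead n M M0c≡0 Mr0≡0 = begin
  laplaceTerm M zero + (laplaceTerm M (suc zero) + Σᶠ n (λ c → laplaceTerm M (suc (suc c))))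
    ≡⟨ cong₂ (λ d₁ rest → laplaceTerm M zero + (- 1ℚ * (m₀₁ * d₁) + rest))
             (det-firstColHead n (minorAt M (suc zero)) Mr0≡0)
             (Σᶠ-zero n (λ c → laplaceTerm-zeroEntry M (suc (suc c)) (M0c≡0 c))) ⟩
  1ℚ * (m₀₀ * d₀) + (- 1ℚ * (m₀₁ * (m₁₀ * d₂)) + 0ℚ)
    ≡⟨ expand m₀₀ m₀₁ m₁₀ d₀ d₂ ⟩
  m₀₀ * d₀ - m₀₁ * (m₁₀ * d₂)
    ∎
  where
  open ≡-Reasoning
  m₀₀ = M zero zero
  m₀₁ = M zero (suc zero)
  m₁₀ = M (suc zero) zero
  d₀ = det (suc n) (minorAt M zero)
  d₂ = det n (λ r c → M (suc (suc r)) (suc (suc c)))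
  expand : ∀ a b c d₀ d₂ → 1ℚ * (a * d₀) + (- 1ℚ * (b * (c * d₂)) + 0ℚ) ≡ a * d₀ - b * (c * d₂)
  expand = solve-∀ ℚ-ring

-- det (X · A) = (n + 1) · det X

fromℕ : ℕ → ℚ
fromℕ zero    = 0ℚ
fromℕ (suc m) = 1ℚ + fromℕ m

fromℕ-+ : ∀ m n → fromℕ (m ℕ.+ n) ≡ fromℕ m + fromℕ n
fromℕ-+ zero    n = sym (ℚP.+-identityˡ (fromℕ n))
fromℕ-+ (suc m) n = trans (cong (_+_ 1ℚ) (fromℕ-+ m n)) (sym (ℚP.+-assoc 1ℚ (fromℕ m) (fromℕ n)))

fromℕ-* : ∀ m n → fromℕ (m ℕ.* n) ≡ fromℕ m * fromℕ n
fromℕ-* zero    n = sym (ℚP.*-zeroˡ (fromℕ n))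
fromℕ-* (suc m) n = begin
  fromℕ (n ℕ.+ m ℕ.* n)        ≡⟨ fromℕ-+ n (m ℕ.* n) ⟩
  fromℕ n + fromℕ (m ℕ.* n)    ≡⟨ cong (_+_ (fromℕ n)) (fromℕ-* m n) ⟩
  fromℕ n + fromℕ m * fromℕ n  ≡⟨ distrib (fromℕ m) (fromℕ n) ⟩
  (1ℚ + fromℕ m) * fromℕ n     ∎
  where
  open ≡-Reasoning
  distrib : ∀ x y → y + x * y ≡ (1ℚ + x) * y
  distrib = solve-∀ ℚ-ring

toℚᵘ-fromℕ : ∀ m → toℚᵘ (fromℕ m) ≃ mkℚᵘ (ℤ.+ m) 0
toℚᵘ-fromℕ zero    = ℚᵘP.≃-refl
toℚᵘ-fromℕ (suc m) =
  ℚᵘP.≃-trans (ℚP.toℚᵘ-homo-+ 1ℚ (fromℕ m))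
    (ℚᵘP.≃-trans (ℚᵘP.+-cong (ℚᵘP.≃-refl {mkℚᵘ (ℤ.+ 1) 0}) (toℚᵘ-fromℕ m)) (*≡* (1+ (ℤ.+ m))))
  where
  1+ : ∀ z → (ℤ.+ 1 ℤ.* ℤ.+ 1 ℤ.+ z ℤ.* ℤ.+ 1) ℤ.* ℤ.+ 1 ≡ (ℤ.+ 1 ℤ.+ z) ℤ.* ℤ.+ 1
  1+ = ℤ-Solver.solve-∀

fromℕ≢0 : ∀ m → .{{ℕ.NonZero m}} → fromℕ m ≢ 0ℚ
fromℕ≢0 (suc m) eq with ℚᵘP.≃-trans (ℚᵘP.≃-sym (toℚᵘ-fromℕ (suc m))) (ℚᵘP.≃-reflexive (cong toℚᵘ eq))
... | *≡* ()

fromℕ-cancelˡ : ∀ m .{{_ : ℕ.NonZero m}} {x y} → fromℕ m * x ≡ fromℕ m * y → x ≡ y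
fromℕ-cancelˡ m {x} {y} mx≡my = begin
  x                 ≡⟨ sym (undo x) ⟩
  m⁻¹ * (fromℕ m * x) ≡⟨ cong (m⁻¹ *_) mx≡my ⟩
  m⁻¹ * (fromℕ m * y) ≡⟨ undo y ⟩
  y                 ∎
  where
  open ≡-Reasoning
  instance _ = ℚ.≢-nonZero (fromℕ≢0 m)
  m⁻¹ = ℚ.1/ fromℕ m
  undo : ∀ z → m⁻¹ * (fromℕ m * z) ≡ z
  undo z = trans (sym (ℚP.*-assoc m⁻¹ (fromℕ m) z))
                 (trans (cong (_* z) (ℚP.*-inverseˡ (fromℕ m))) (ℚP.*-identityˡ z))

fromℕ-*-/ : ∀ d P → fromℕ (suc d) * ((ℤ.+ P) / suc d) ≡ fromℕ P
fromℕ-*-/ d P = ℚP.toℚᵘ-injective (begin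
  toℚᵘ (fromℕ (suc d) * ((ℤ.+ P) / suc d))        ≈⟨ ℚP.toℚᵘ-homo-* (fromℕ (suc d)) ((ℤ.+ P) / suc d) ⟩
  toℚᵘ (fromℕ (suc d)) ℚᵘ.* toℚᵘ ((ℤ.+ P) / suc d) ≈⟨ ℚᵘP.*-cong (toℚᵘ-fromℕ (suc d))
                                                                  (ℚP.toℚᵘ-fromℚᵘ (mkℚᵘ (ℤ.+ P) d)) ⟩
  mkℚᵘ (ℤ.+ suc d) 0 ℚᵘ.* mkℚᵘ (ℤ.+ P) d          ≈⟨ *≡* cross-multiplied ⟩
  mkℚᵘ (ℤ.+ P) 0                                 ≈⟨ ℚᵘP.≃-sym (toℚᵘ-fromℕ P) ⟩
  toℚᵘ (fromℕ P)                                 ∎)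
  where
  open ℚᵘP.≃-Reasoning
  cross-multiplied : (ℤ.+ suc d ℤ.* ℤ.+ P) ℤ.* ℤ.+ 1 ≡ ℤ.+ P ℤ.* ℤ.+ suc (d ℕ.+ 0)
  cross-multiplied rewrite ℕP.+-identityʳ d = comm (ℤ.+ suc d) (ℤ.+ P)
    where
    comm : ∀ a b → a ℤ.* b ℤ.* ℤ.+ 1 ≡ b ℤ.* a
    comm = ℤ-Solver.solve-∀

prefixCols : ∀ {m n} → ℕ → Mat m n → Mat m n → Mat m n
prefixCols p U V r k with toℕ k ℕ.<? p
... | yes _ = U r k
... | no  _ = V r k

prefixCols-< : ∀ {m n} p (U V : Mat m n) r k → toℕ k < p → prefixCols p U V r k ≡ U r k
prefixCols-< p U V r k k<p with toℕ k ℕ.<? p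
... | yes _   = refl
... | no  k≮p = ⊥-elim (k≮p k<p)

prefixCols-≮ : ∀ {m n} p (U V : Mat m n) r k → ¬ toℕ k < p → prefixCols p U V r k ≡ V r k
prefixCols-≮ p U V r k k≮p with toℕ k ℕ.<? p
... | yes k<p = ⊥-elim (k≮p k<p)
... | no  _   = refl

prefixCols-new : ∀ {m n} (U V : Mat m n) r k → prefixCols (suc (toℕ k)) U V r k ≡ U r k
prefixCols-new U V r k = prefixCols-< (suc (toℕ k)) U V r k (ℕP.n<1+n (toℕ k))

prefixCols-old : ∀ {m n} (U V : Mat m n) r k → prefixCols (toℕ k) U V r k ≡ V r k
prefixCols-old U V r k = prefixCols-≮ (toℕ k) U V r k (ℕP.<-irrefl refl)

prefixCols-others : ∀ {m n} (U V : Mat m n) r k j → j ≢ k →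
                    prefixCols (suc (toℕ k)) U V r j ≡ prefixCols (toℕ k) U V r j
prefixCols-others U V r k j j≢k with toℕ j ℕ.<? toℕ k
... | yes j<k = prefixCols-< (suc (toℕ k)) U V r j (ℕP.m<n⇒m<1+n j<k)
... | no  j≮k = prefixCols-≮ (suc (toℕ k)) U V r j λ j<1+k →
                  j≮k (ℕP.≤∧≢⇒< (ℕ.s≤s⁻¹ j<1+k) (j≢k ∘ FinP.toℕ-injective))

∏< : (ℕ → ℕ) → ℕ → ℕ
∏< c zero    = 1
∏< c (suc p) = c p ℕ.* ∏< c p

det-prefixCols-telescope : ∀ n (U V : Mat n n) (c : ℕ → ℕ) →
  (∀ (k : Fin n) → det n (prefixCols (suc (toℕ k)) U V) ≡ fromℕ (c (toℕ k)) * det n (prefixCols (toℕ k) U V)) →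
  det n U ≡ fromℕ (∏< c n) * det n V
det-prefixCols-telescope n U V c step =
  trans (det-cong n (λ r k → sym (prefixCols-< n U V r k (FinP.toℕ<n k)))) (up-to n ℕP.≤-refl)
  where
  1* : ∀ x → (1ℚ + 0ℚ) * x ≡ x
  1* = solve-∀ ℚ-ring
  step-at : ∀ p → p < n → det n (prefixCols (suc p) U V) ≡ fromℕ (c p) * det n (prefixCols p U V)
  step-at p p<n = subst (λ p → det n (prefixCols (suc p) U V) ≡ fromℕ (c p) * det n (prefixCols p U V))
                        (FinP.toℕ-fromℕ< p<n) (step (fromℕ< p<n))
  up-to : ∀ p → p ≤ n → det n (prefixCols p U V) ≡ fromℕ (∏< c p) * det n V
  up-to zero    _   = trans (det-cong n (λ r k → prefixCols-≮ 0 U V r k λ ())) (sym (1* (det n V)))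
  up-to (suc p) p<n = begin
    det n (prefixCols (suc p) U V)                 ≡⟨ step-at p p<n ⟩
    fromℕ (c p) * det n (prefixCols p U V)         ≡⟨ cong (fromℕ (c p) *_) (up-to p (ℕP.<⇒≤ p<n)) ⟩
    fromℕ (c p) * (fromℕ (∏< c p) * det n V)       ≡⟨ sym (ℚP.*-assoc (fromℕ (c p)) (fromℕ (∏< c p)) (det n V)) ⟩
    fromℕ (c p) * fromℕ (∏< c p) * det n V         ≡⟨ cong (_* det n V) (sym (fromℕ-* (c p) (∏< c p))) ⟩
    fromℕ (∏< c (suc p)) * det n V                 ∎
    where open ≡-Reasoning

∏<-suc : ∀ n → ∏< suc n ≡ n !
∏<-suc zero    = refl
∏<-suc (suc n) = cong (suc n ℕ.*_) (∏<-suc n)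

∏<-2+ : ∀ n → ∏< (λ p → suc (suc p)) n ≡ suc n !
∏<-2+ zero    = refl
∏<-2+ (suc n) = cong (suc (suc n) ℕ.*_) (∏<-2+ n)

cartan : ℕ → ℕ → ℚ
cartan (suc i)       (suc j)       = cartan i j
cartan zero          zero          = fromℕ 2
cartan zero          (suc zero)    = - 1ℚ
cartan zero          (suc (suc _)) = 0ℚ
cartan (suc zero)    zero          = - 1ℚ
cartan (suc (suc _)) zero          = 0ℚ

cartan-diag : ∀ i → cartan i i ≡ fromℕ 2
cartan-diag zero    = refl
cartan-diag (suc i) = cartan-diag i

cartan-up : ∀ i → cartan i (suc i) ≡ - 1ℚ
cartan-up zero    = refl
cartan-up (suc i) = cartan-up i

cartan-down : ∀ j → cartan (suc j) j ≡ - 1ℚ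
cartan-down zero    = refl
cartan-down (suc j) = cartan-down j

cartan-farRight : ∀ i j → suc (suc i) ≤ j → cartan i j ≡ 0ℚ
cartan-farRight zero    (suc (suc j)) _         = refl
cartan-farRight zero    (suc zero)    (s≤s ())
cartan-farRight (suc i) (suc j)       (s≤s 2+i≤j) = cartan-farRight i j 2+i≤j

cartan-farLeft : ∀ i j → suc (suc j) ≤ i → cartan i j ≡ 0ℚ
cartan-farLeft (suc (suc i)) zero    _           = refl
cartan-farLeft (suc zero)    zero    (s≤s ())
cartan-farLeft (suc i)       (suc j) (s≤s 2+j≤i) = cartan-farLeft i j 2+j≤i

cartan-off : ∀ i j → i ≢ j → suc i ≢ j → i ≢ suc j → cartan i j ≡ 0ℚ
cartan-off zero          zero          i≢j _     _     = ⊥-elim (i≢j refl)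
cartan-off zero          (suc zero)    _   1+i≢j _     = ⊥-elim (1+i≢j refl)
cartan-off zero          (suc (suc j)) _   _     _     = refl
cartan-off (suc zero)    zero          _   _     i≢1+j = ⊥-elim (i≢1+j refl)
cartan-off (suc (suc i)) zero          _   _     _     = refl
cartan-off (suc i)       (suc j)       i≢j 1+i≢j i≢1+j =
  cartan-off i j (i≢j ∘ cong suc) (1+i≢j ∘ cong suc) (i≢1+j ∘ cong suc)

cartanA-toℕ : ∀ n (i j : Fin n) → cartanA n i j ≡ cartan (toℕ i) (toℕ j)
cartanA-toℕ n i j with toℕ i ℕ.≟ toℕ j | suc (toℕ i) ℕ.≟ toℕ j | toℕ i ℕ.≟ suc (toℕ j)
... | yes i≡j | _        | _        = sym (trans (cong (λ k → cartan k (toℕ j)) i≡j) (cartan-diag (toℕ j)))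
... | no _    | yes 1+i≡j | _       = sym (trans (cong (cartan (toℕ i)) (sym 1+i≡j)) (cartan-up (toℕ i)))
... | no _    | no _     | yes i≡1+j = sym (trans (cong (λ k → cartan k (toℕ j)) i≡1+j) (cartan-down (toℕ j)))
... | no i≢j  | no 1+i≢j | no i≢1+j  = sym (cartan-off (toℕ i) (toℕ j) i≢j 1+i≢j i≢1+j)

padded : ∀ {n} → (Fin n → ℚ) → ℕ → ℚ
padded {zero}  v _       = 0ℚ
padded {suc n} v zero    = v zero
padded {suc n} v (suc t) = padded (v ∘ suc) t

padded-toℕ : ∀ {n} (v : Fin n → ℚ) k → padded v (toℕ k) ≡ v k
padded-toℕ v zero    = refl
padded-toℕ v (suc k) = padded-toℕ (v ∘ suc) k

padded-≥ : ∀ {n} (v : Fin n → ℚ) t → n ≤ t → padded v t ≡ 0ℚ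
padded-≥ {zero}  v t       _         = refl
padded-≥ {suc n} v (suc t) (s≤s n≤t) = padded-≥ (v ∘ suc) t n≤t

timesCartan : (ℕ → ℚ) → ℕ → ℚ
timesCartan x zero    = fromℕ 2 * x 0 - x 1
timesCartan x (suc t) = fromℕ 2 * x (suc t) - x t - x (suc (suc t))

Σᶠ-*-cartan : ∀ n (v : Fin n → ℚ) t → Σᶠ n (λ j → v j * cartan (toℕ j) t) ≡ timesCartan (padded v) t
Σᶠ-*-cartan zero    v zero    = refl
Σᶠ-*-cartan zero    v (suc t) = refl
Σᶠ-*-cartan (suc n) v zero    =
  trans (cong (_+_ (v zero * fromℕ 2)) (first-column n (v ∘ suc))) (shape (v zero) (padded (v ∘ suc) 0))
  where
  shape : ∀ a b → a * fromℕ 2 + - b ≡ fromℕ 2 * a - b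
  shape = solve-∀ ℚ-ring
  first-column : ∀ n (w : Fin n → ℚ) → Σᶠ n (λ j → w j * cartan (suc (toℕ j)) zero) ≡ - padded w 0
  first-column zero    w = refl
  first-column (suc n) w =
    trans (cong (_+_ (w zero * - 1ℚ)) (Σᶠ-zero n (λ j → ℚP.*-zeroʳ (w (suc j))))) (neg (w zero))
    where
    neg : ∀ a → a * - 1ℚ + 0ℚ ≡ - a
    neg = solve-∀ ℚ-ring
Σᶠ-*-cartan (suc n) v (suc zero) =
  trans (cong (_+_ (v zero * - 1ℚ)) (Σᶠ-*-cartan n (v ∘ suc) zero)) (shape (v zero) (padded v 1) (padded v 2))
  where
  shape : ∀ a b c → a * - 1ℚ + (fromℕ 2 * b - c) ≡ fromℕ 2 * b - a - c
  shape = solve-∀ ℚ-ring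
Σᶠ-*-cartan (suc n) v (suc (suc t)) =
  trans (cong₂ _+_ (ℚP.*-zeroʳ (v zero)) (Σᶠ-*-cartan n (v ∘ suc) (suc t))) (ℚP.+-identityˡ _)

·cartanA-toℕ : ∀ n (X : Mat n n) r k → (X · cartanA n) r k ≡ timesCartan (padded (X r)) (toℕ k)
·cartanA-toℕ n X r k =
  trans (Σᶠ-cong n (λ j → cong (X r j *_) (cartanA-toℕ n j k))) (Σᶠ-*-cartan n (X r) (toℕ k))

bidiagonal : (ℕ → ℚ) → ℕ → ℚ
bidiagonal x t = fromℕ (suc (suc t)) * x t - fromℕ (suc t) * x (suc t)

bidiagonal-zero : ∀ x → bidiagonal x 0 ≡ fromℕ 1 * timesCartan x 0
bidiagonal-zero x = shape (x 0) (x 1)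
  where
  shape : ∀ a b → (1ℚ + (1ℚ + 0ℚ)) * a - (1ℚ + 0ℚ) * b ≡ (1ℚ + 0ℚ) * ((1ℚ + (1ℚ + 0ℚ)) * a - b)
  shape = solve-∀ ℚ-ring

bidiagonal-suc : ∀ x t → bidiagonal x (suc t) ≡ fromℕ (suc (suc t)) * timesCartan x (suc t) + 1ℚ * bidiagonal x t
bidiagonal-suc x t = shape (fromℕ t) (x t) (x (suc t)) (x (suc (suc t)))
  where
  shape : ∀ F a b c → (1ℚ + (1ℚ + (1ℚ + F))) * b - (1ℚ + (1ℚ + F)) * c
                    ≡ (1ℚ + (1ℚ + F)) * ((1ℚ + (1ℚ + 0ℚ)) * b - a - c) + 1ℚ * ((1ℚ + (1ℚ + F)) * a - (1ℚ + F) * b)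
  shape = solve-∀ ℚ-ring

bidiagonal-expand : ∀ x t → bidiagonal x t ≡ fromℕ (suc (suc t)) * x t + - fromℕ (suc t) * x (suc t)
bidiagonal-expand x t = shape (fromℕ (suc (suc t))) (fromℕ (suc t)) (x t) (x (suc t))
  where
  shape : ∀ F G a b → F * a - G * b ≡ F * a + - G * b
  shape = solve-∀ ℚ-ring

bidiagonalCols : ∀ {n} → Mat n n → Mat n n
bidiagonalCols X r k = bidiagonal (padded (X r)) (toℕ k)

-- Column by column from the left: column k of X · A becomes k + 1 times itself plus the new
-- column k − 1, and column k of X becomes k + 2 times itself minus k + 1 times column k + 1.
det-bidiagonalCols≡n!*det[X·A] : ∀ n (X : Mat n n) → det n (bidiagonalCols X) ≡ fromℕ (n !) * det n (X · cartanA n)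
det-bidiagonalCols≡n!*det[X·A] n X =
  trans (det-prefixCols-telescope n (bidiagonalCols X) (X · cartanA n) suc (step n X))
        (cong (λ m → fromℕ m * det n (X · cartanA n)) (∏<-suc n))
  where
  step : ∀ m (Y : Mat m m) (k : Fin m) →
         det m (prefixCols (suc (toℕ k)) (bidiagonalCols Y) (Y · cartanA m))
           ≡ fromℕ (suc (toℕ k)) * det m (prefixCols (toℕ k) (bidiagonalCols Y) (Y · cartanA m))
  step (suc m) Y zero = det-scaleCol (suc m) (prefixCols 0 B YA) (prefixCols 1 B YA) zero (fromℕ 1)
    (λ r → begin
      prefixCols 1 B YA r zero                 ≡⟨ prefixCols-new B YA r zero ⟩
      bidiagonal (padded (Y r)) 0              ≡⟨ bidiagonal-zero (padded (Y r)) ⟩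
      fromℕ 1 * timesCartan (padded (Y r)) 0   ≡⟨ cong (fromℕ 1 *_) (sym (·cartanA-toℕ (suc m) Y r zero)) ⟩
      fromℕ 1 * YA r zero                      ≡⟨ cong (fromℕ 1 *_) (sym (prefixCols-old B YA r zero)) ⟩
      fromℕ 1 * prefixCols 0 B YA r zero       ∎)
    (λ r j j≢0 → prefixCols-others B YA r zero j j≢0)
    where
    open ≡-Reasoning
    B = bidiagonalCols Y
    YA = Y · cartanA (suc m)
  step (suc m) Y (suc k) =
    det-addAdjacentCol (suc m) M (prefixCols (suc (suc (toℕ k))) B YA) (suc k) (inject₁ k)
      F 1ℚ (inj₂ (cong suc (sym (FinP.toℕ-inject₁ k))))
      (λ r → begin
        prefixCols (suc (suc (toℕ k))) B YA r (suc k)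
          ≡⟨ prefixCols-new B YA r (suc k) ⟩
        bidiagonal (padded (Y r)) (suc (toℕ k))
          ≡⟨ bidiagonal-suc (padded (Y r)) (toℕ k) ⟩
        F * timesCartan (padded (Y r)) (suc (toℕ k)) + 1ℚ * bidiagonal (padded (Y r)) (toℕ k)
          ≡⟨ cong₂ (λ a b → F * a + 1ℚ * b) (this-col r) (previous-col r) ⟩
        F * M r (suc k) + 1ℚ * M r (inject₁ k)
          ∎)
      (λ r j j≢k → prefixCols-others B YA r (suc k) j j≢k)
    where
    open ≡-Reasoning
    B = bidiagonalCols Y
    YA = Y · cartanA (suc m)
    M = prefixCols (suc (toℕ k)) B YA
    F = fromℕ (suc (suc (toℕ k)))
    this-col : ∀ r → timesCartan (padded (Y r)) (suc (toℕ k)) ≡ M r (suc k)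
    this-col r = trans (sym (·cartanA-toℕ (suc m) Y r (suc k))) (sym (prefixCols-old B YA r (suc k)))
    previous-col : ∀ r → bidiagonal (padded (Y r)) (toℕ k) ≡ M r (inject₁ k)
    previous-col r = trans (cong (bidiagonal (padded (Y r))) (sym (FinP.toℕ-inject₁ k)))
                           (sym (prefixCols-< (suc (toℕ k)) B YA r (inject₁ k) (s≤s (ℕP.≤-reflexive (FinP.toℕ-inject₁ k)))))

det-bidiagonalCols≡[1+n]!*det[X] : ∀ n (X : Mat n n) → det n (bidiagonalCols X) ≡ fromℕ (suc n !) * det n X
det-bidiagonalCols≡[1+n]!*det[X] n X =
  trans (det-prefixCols-telescope n B X (λ p → suc (suc p)) step)
        (cong (λ m → fromℕ m * det n X) (∏<-2+ n))
  where
  B = bidiagonalCols X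
  step : ∀ k → det n (prefixCols (suc (toℕ k)) B X) ≡ fromℕ (suc (suc (toℕ k))) * det n (prefixCols (toℕ k) B X)
  step k = by-next-col (suc (toℕ k) ℕ.<? n)
    where
    open ≡-Reasoning
    M = prefixCols (toℕ k) B X
    M′ = prefixCols (suc (toℕ k)) B X
    F = fromℕ (suc (suc (toℕ k)))
    G = fromℕ (suc (toℕ k))
    col-k : ∀ r → M′ r k ≡ F * M r k + - G * padded (X r) (suc (toℕ k))
    col-k r = begin
      M′ r k                                                       ≡⟨ prefixCols-new B X r k ⟩
      bidiagonal (padded (X r)) (toℕ k)                            ≡⟨ bidiagonal-expand (padded (X r)) (toℕ k) ⟩
      F * padded (X r) (toℕ k) + - G * padded (X r) (suc (toℕ k))  ≡⟨ cong (λ a → F * a + - G * padded (X r) (suc (toℕ k)))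
                                                                           (trans (padded-toℕ (X r) k) (sym (prefixCols-old B X r k))) ⟩
      F * M r k + - G * padded (X r) (suc (toℕ k))                 ∎
    others : ∀ r j → j ≢ k → M′ r j ≡ M r j
    others r j j≢k = prefixCols-others B X r k j j≢k
    drop : ∀ a g → a + - g * 0ℚ ≡ a
    drop = solve-∀ ℚ-ring

    by-next-col : Dec (suc (toℕ k) < n) → det n M′ ≡ F * det n M
    by-next-col (yes 1+k<n) = det-addAdjacentCol n M M′ k k+1 F (- G) (inj₁ (FinP.toℕ-fromℕ< 1+k<n))
      (λ r → trans (col-k r) (cong (λ b → F * M r k + - G * b) (begin
        padded (X r) (suc (toℕ k)) ≡⟨ cong (padded (X r)) (sym (FinP.toℕ-fromℕ< 1+k<n)) ⟩
        padded (X r) (toℕ k+1)     ≡⟨ padded-toℕ (X r) k+1 ⟩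
        X r k+1                    ≡⟨ sym (prefixCols-≮ (toℕ k) B X r k+1 (ℕP.<⇒≯ (ℕP.≤-reflexive (sym (FinP.toℕ-fromℕ< 1+k<n))))) ⟩
        M r k+1                    ∎)))
      others
      where k+1 = fromℕ< 1+k<n
    by-next-col (no 1+k≮n) = det-scaleCol n M M′ k F
      (λ r → trans (col-k r) (trans (cong (λ b → F * M r k + - G * b) (padded-≥ (X r) (suc (toℕ k)) (ℕP.≮⇒≥ 1+k≮n)))
                                    (drop (F * M r k) G)))
      others

det-·-cartanA : ∀ n (X : Mat n n) → det n (X · cartanA n) ≡ fromℕ (suc n) * det n X
det-·-cartanA n X = fromℕ-cancelˡ (n !) {{ℕP._!≢0 n}} (begin
  fromℕ (n !) * det n (X · cartanA n)         ≡⟨ sym (det-bidiagonalCols≡n!*det[X·A] n X) ⟩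
  det n (bidiagonalCols X)                    ≡⟨ det-bidiagonalCols≡[1+n]!*det[X] n X ⟩
  fromℕ (suc n ℕ.* n !) * det n X             ≡⟨ cong (_* det n X) (trans (fromℕ-* (suc n) (n !))
                                                                          (ℚP.*-comm (fromℕ (suc n)) (fromℕ (n !)))) ⟩
  fromℕ (n !) * fromℕ (suc n) * det n X       ≡⟨ ℚP.*-assoc (fromℕ (n !)) (fromℕ (suc n)) (det n X) ⟩
  fromℕ (n !) * (fromℕ (suc n) * det n X)     ∎)
  where open ≡-Reasoning

-- Minors of the Cartan matrix

data ZeroOr±Divisor! (B : ℕ) (q : ℚ) : Set where
  zero≡ : q ≡ 0ℚ → ZeroOr±Divisor! B q
  +∣!≡  : ∀ P → P ℕD.∣ B ! → q ≡ fromℕ P → ZeroOr±Divisor! B q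
  -∣!≡  : ∀ P → P ℕD.∣ B ! → q ≡ - fromℕ P → ZeroOr±Divisor! B q

ZeroOr±Divisor!-one : ∀ {B} → ZeroOr±Divisor! B 1ℚ
ZeroOr±Divisor!-one {B} = +∣!≡ 1 (ℕD.1∣ (B !)) refl

ZeroOr±Divisor!-mono : ∀ {B B′ q} → B ≤ B′ → ZeroOr±Divisor! B q → ZeroOr±Divisor! B′ q
ZeroOr±Divisor!-mono B≤B′ (zero≡ q≡0)        = zero≡ q≡0
ZeroOr±Divisor!-mono B≤B′ (+∣!≡ P P∣B! q≡P)  = +∣!≡ P (ℕD.∣-trans P∣B! (ℕD.m≤n⇒m!∣n! B≤B′)) q≡P
ZeroOr±Divisor!-mono B≤B′ (-∣!≡ P P∣B! q≡-P) = -∣!≡ P (ℕD.∣-trans P∣B! (ℕD.m≤n⇒m!∣n! B≤B′)) q≡-P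

ZeroOr±Divisor!-neg : ∀ {B q} → ZeroOr±Divisor! B q → ZeroOr±Divisor! B (- q)
ZeroOr±Divisor!-neg (zero≡ q≡0)        = zero≡ (cong -_ q≡0)
ZeroOr±Divisor!-neg (+∣!≡ P P∣B! q≡P)  = -∣!≡ P P∣B! (cong -_ q≡P)
ZeroOr±Divisor!-neg (-∣!≡ P P∣B! q≡-P) = +∣!≡ P P∣B! (trans (cong -_ q≡-P) (neg-involutive (fromℕ P)))
  where
  neg-involutive : ∀ x → - - x ≡ x
  neg-involutive = solve-∀ ℚ-ring

ZeroOr±Divisor!-sgn : ∀ {B q} t → ZeroOr±Divisor! B q → ZeroOr±Divisor! B (sgn t * q)
ZeroOr±Divisor!-sgn {B} {q} zero          d = subst (ZeroOr±Divisor! B) (sym (ℚP.*-identityˡ q)) d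
ZeroOr±Divisor!-sgn {B} {q} (suc zero)    d = subst (ZeroOr±Divisor! B) (sym (-1*x≡-x q)) (ZeroOr±Divisor!-neg d)
ZeroOr±Divisor!-sgn         (suc (suc t)) d = ZeroOr±Divisor!-sgn t d

suc*∣suc+! : ∀ m B → suc m ℕ.* B ! ℕD.∣ (suc m ℕ.+ B) !
suc*∣suc+! m B = ℕD.∣-trans (ℕD.*-monoˡ-∣ (B !) (ℕD.m∣m*n {suc m} (m !)))
                            (subst (λ b → suc m ! ℕ.* b ! ℕD.∣ (suc m ℕ.+ B) !) (ℕP.m+n∸m≡n (suc m) B)
                                   (k![n∸k]!∣n! (ℕP.m≤m+n (suc m) B)))

ZeroOr±Divisor!-scale : ∀ m {B q} → ZeroOr±Divisor! B q → ZeroOr±Divisor! (suc m ℕ.+ B) (fromℕ (suc m) * q)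
ZeroOr±Divisor!-scale m (zero≡ q≡0) = zero≡ (trans (cong (fromℕ (suc m) *_) q≡0) (ℚP.*-zeroʳ (fromℕ (suc m))))
ZeroOr±Divisor!-scale m {B} (+∣!≡ P P∣B! refl) =
  +∣!≡ (suc m ℕ.* P) (ℕD.∣-trans (ℕD.*-monoʳ-∣ (suc m) P∣B!) (suc*∣suc+! m B)) (sym (fromℕ-* (suc m) P))
ZeroOr±Divisor!-scale m {B} (-∣!≡ P P∣B! refl) =
  -∣!≡ (suc m ℕ.* P) (ℕD.∣-trans (ℕD.*-monoʳ-∣ (suc m) P∣B!) (suc*∣suc+! m B))
       (trans (x*-y≡-[x*y] (fromℕ (suc m)) (fromℕ P)) (cong -_ (sym (fromℕ-* (suc m) P))))

Increasing : ∀ {r} → (Fin r → ℕ) → Set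
Increasing {r} J = ∀ (a b : Fin r) → a Fin.< b → J a < J b

Increasing-tail : ∀ {r} {J : Fin (suc r) → ℕ} → Increasing J → Increasing (J ∘ suc)
Increasing-tail J↑ a b a<b = J↑ (suc a) (suc b) (s≤s a<b)

Increasing-head< : ∀ {r} {J : Fin (suc r) → ℕ} → Increasing J → ∀ a → J zero < J (suc a)
Increasing-head< J↑ a = J↑ zero (suc a) (s≤s z≤n)

Increasing-head≤ : ∀ {r} {J : Fin (suc r) → ℕ} → Increasing J → ∀ a → J zero ≤ J a
Increasing-head≤ J↑ zero    = ℕP.≤-refl
Increasing-head≤ J↑ (suc a) = ℕP.<⇒≤ (Increasing-head< J↑ a)

Increasing-head+2≤ : ∀ {r} {J : Fin (suc (suc r)) → ℕ} → Increasing J → ∀ a → suc (suc (J zero)) ≤ J (suc (suc a))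
Increasing-head+2≤ J↑ a = ℕP.<-≤-trans (s≤s (Increasing-head< J↑ zero)) (Increasing-head< (Increasing-tail J↑) a)

Increasing-injective : ∀ {r} {J : Fin r → ℕ} → Increasing J → ∀ a b → a ≢ b → J a ≢ J b
Increasing-injective J↑ a b a≢b Ja≡Jb with FinP.<-cmp a b
... | tri< a<b _ _ = ℕP.<-irrefl Ja≡Jb (J↑ a b a<b)
... | tri≈ _ a≡b _ = a≢b a≡b
... | tri> _ _ b<a = ℕP.<-irrefl (sym Ja≡Jb) (J↑ b a b<a)

Increasing-punchIn : ∀ {r} {J : Fin (suc r) → ℕ} → Increasing J → ∀ p → Increasing (J ∘ punchIn p)
Increasing-punchIn J↑ p a b a<b = J↑ (punchIn p a) (punchIn p b) (ℕP.≤∧≢⇒< (FinP.punchIn-mono-≤ p a b (ℕP.<⇒≤ a<b))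
  λ pa≡pb → FinP.<-irrefl (FinP.punchIn-injective p a b (FinP.toℕ-injective pa≡pb)) a<b)

cartanMinor : ∀ r → (Fin r → ℕ) → (Fin r → ℕ) → ℚ
cartanMinor r J K = det r (λ a b → cartan (J a) (K b))

∸-suc : ∀ {s n} → s < n → n ∸ s ≡ suc (n ∸ suc s)
∸-suc {s} {n} s<n = ℕP.+-∸-assoc 1 {n} {suc s} s<n

2+m+[n∸1+s]≡[n∸s]+1+m : ∀ {s n} m → s < n → suc (suc m) ℕ.+ (n ∸ suc s) ≡ (n ∸ s) ℕ.+ suc m
2+m+[n∸1+s]≡[n∸s]+1+m m s<n rewrite ∸-suc s<n = cong suc (ℕP.+-comm (suc m) _)

[n∸1+s]+2+m≡[n∸s]+1+m : ∀ {s n} m → s < n → (n ∸ suc s) ℕ.+ suc (suc m) ≡ (n ∸ s) ℕ.+ suc m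
[n∸1+s]+2+m≡[n∸s]+1+m m s<n rewrite ∸-suc s<n = ℕP.+-suc _ (suc m)

cartanMinor-continuant : ∀ r (J K : Fin (suc (suc r)) → ℕ) → Increasing J → Increasing K → J zero ≡ K zero →
  cartanMinor (suc (suc r)) J K
    ≡ fromℕ 2 * cartanMinor (suc r) (J ∘ suc) (K ∘ suc)
      - cartan (J zero) (K (suc zero)) * cartan (J (suc zero)) (K zero) * cartanMinor r (λ a → J (suc (suc a))) (λ b → K (suc (suc b)))
cartanMinor-continuant r J K J↑ K↑ J₀≡K₀ =
  trans (det-tridiagonalHead r (λ a b → cartan (J a) (K b)) row₀ col₀)
        (cong₂ (λ c d → c * D′ - d) (trans (cong (cartan (J zero)) (sym J₀≡K₀)) (cartan-diag (J zero)))
                                     (sym (ℚP.*-assoc (cartan (J zero) (K (suc zero))) (cartan (J (suc zero)) (K zero)) D″)))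
  where
  D′ = cartanMinor (suc r) (J ∘ suc) (K ∘ suc)
  D″ = cartanMinor r (λ a → J (suc (suc a))) (λ b → K (suc (suc b)))
  row₀ : ∀ c → cartan (J zero) (K (suc (suc c))) ≡ 0ℚ
  row₀ c = cartan-farRight (J zero) (K (suc (suc c)))
             (subst (λ k → suc (suc k) ≤ K (suc (suc c))) (sym J₀≡K₀) (Increasing-head+2≤ K↑ c))
  col₀ : ∀ a → cartan (J (suc (suc a))) (K zero) ≡ 0ℚ
  col₀ a = cartan-farLeft (J (suc (suc a))) (K zero)
             (subst (λ k → suc (suc k) ≤ J (suc (suc a))) J₀≡K₀ (Increasing-head+2≤ J↑ a))

cartanMinor-runContinues⊎ends : ∀ r (J K : Fin (suc (suc r)) → ℕ) → Increasing J → Increasing K → J zero ≡ K zero →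
  (J (suc zero) ≡ suc (J zero) × K (suc zero) ≡ suc (J zero))
  ⊎ (cartan (J zero) (K (suc zero)) * cartan (J (suc zero)) (K zero) ≡ 0ℚ × suc (suc (J zero)) ≤ J (suc zero) ⊔ K (suc zero))
cartanMinor-runContinues⊎ends r J K J↑ K↑ J₀≡K₀ with J (suc zero) ℕ.≟ suc (J zero) | K (suc zero) ℕ.≟ suc (J zero)
... | yes J₁≡1+J₀ | yes K₁≡1+J₀ = inj₁ (J₁≡1+J₀ , K₁≡1+J₀)
... | _           | no K₁≢1+J₀ =
  inj₂ (trans (cong (_* cartan (J (suc zero)) (K zero)) (cartan-farRight (J zero) (K (suc zero)) 2+J₀≤K₁))
              (ℚP.*-zeroˡ (cartan (J (suc zero)) (K zero)))
       , ℕP.≤-trans 2+J₀≤K₁ (ℕP.m≤n⊔m (J (suc zero)) (K (suc zero))))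
  where
  2+J₀≤K₁ : suc (suc (J zero)) ≤ K (suc zero)
  2+J₀≤K₁ = ℕP.≤∧≢⇒< (subst (_< K (suc zero)) (sym J₀≡K₀) (Increasing-head< K↑ zero)) (K₁≢1+J₀ ∘ sym)
... | no J₁≢1+J₀  | yes _ =
  inj₂ (trans (cong (cartan (J zero) (K (suc zero)) *_)
                    (cartan-farLeft (J (suc zero)) (K zero) (subst (λ k → suc (suc k) ≤ J (suc zero)) J₀≡K₀ 2+J₀≤J₁)))
              (ℚP.*-zeroʳ (cartan (J zero) (K (suc zero))))
       , ℕP.≤-trans 2+J₀≤J₁ (ℕP.m≤m⊔n (J (suc zero)) (K (suc zero))))
  where
  2+J₀≤J₁ : suc (suc (J zero)) ≤ J (suc zero)
  2+J₀≤J₁ = ℕP.≤∧≢⇒< (Increasing-head< J↑ zero) (J₁≢1+J₀ ∘ sym)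

-- The diagonal runs of the minor lie in [J zero ⊔ K zero , n), which bounds their total size.
ZeroOr±Divisor!-cartanMinor : ∀ n r (J K : Fin (suc r) → ℕ) → Increasing J → Increasing K → (∀ a → J a < n) →
                              ZeroOr±Divisor! (suc n ∸ (J zero ⊔ K zero)) (cartanMinor (suc r) J K)

ZeroOr±Divisor!-cartanMinor-tail : ∀ n r (J K : Fin (suc r) → ℕ) → Increasing J → Increasing K → (∀ a → J a < n) →
                                   ZeroOr±Divisor! (suc n ∸ (J zero ⊔ K zero)) (cartanMinor r (J ∘ suc) (K ∘ suc))

-- On a run J a = K a = J zero + a the recursion D = 2 D′ − D″ turns (m + 1) D − m D′ into
-- (m + 2) D′ − (m + 1) D″; where the run ends D = 2 D′, and the quantity is (m + 2) D′.
ZeroOr±Divisor!-cartanMinor-diagonalRun :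
  ∀ n r (J K : Fin (suc r) → ℕ) → Increasing J → Increasing K → (∀ a → J a < n) → J zero ≡ K zero → ∀ m →
  ZeroOr±Divisor! ((n ∸ J zero) ℕ.+ suc m)
    (fromℕ (suc m) * cartanMinor (suc r) J K - fromℕ m * cartanMinor r (J ∘ suc) (K ∘ suc))

ZeroOr±Divisor!-cartanMinor n r J K J↑ K↑ J<n with ℕP.<-cmp (J zero) (K zero)
... | tri≈ _ J₀≡K₀ _ = subst₂ ZeroOr±Divisor! budget (at-m≡0 (cartanMinor (suc r) J K) (cartanMinor r (J ∘ suc) (K ∘ suc)))
                              (ZeroOr±Divisor!-cartanMinor-diagonalRun n r J K J↑ K↑ J<n J₀≡K₀ 0)
  where
  at-m≡0 : ∀ x y → (1ℚ + 0ℚ) * x - 0ℚ * y ≡ x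
  at-m≡0 = solve-∀ ℚ-ring
  budget : (n ∸ J zero) ℕ.+ 1 ≡ suc n ∸ (J zero ⊔ K zero)
  budget = begin
    (n ∸ J zero) ℕ.+ 1        ≡⟨ ℕP.+-comm (n ∸ J zero) 1 ⟩
    suc (n ∸ J zero)          ≡⟨ sym (ℕP.+-∸-assoc 1 (ℕP.<⇒≤ (J<n zero))) ⟩
    suc n ∸ J zero            ≡⟨ cong (λ k → suc n ∸ k) (sym (ℕP.⊔-idem (J zero))) ⟩
    suc n ∸ (J zero ⊔ J zero) ≡⟨ cong (λ k → suc n ∸ (J zero ⊔ k)) J₀≡K₀ ⟩
    suc n ∸ (J zero ⊔ K zero) ∎
    where open ≡-Reasoning
... | tri< J₀<K₀ _ _ with K zero ℕ.≟ suc (J zero)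
...   | yes K₀≡1+J₀ = subst (ZeroOr±Divisor! _) (sym expand) (ZeroOr±Divisor!-neg (ZeroOr±Divisor!-cartanMinor-tail n r J K J↑ K↑ J<n))
  where
  row₀ : ∀ b → b ≢ zero → cartan (J zero) (K b) ≡ 0ℚ
  row₀ zero    b≢0 = ⊥-elim (b≢0 refl)
  row₀ (suc b) _   = cartan-farRight (J zero) (K (suc b)) (subst (_< K (suc b)) K₀≡1+J₀ (Increasing-head< K↑ b))
  expand : cartanMinor (suc r) J K ≡ - cartanMinor r (J ∘ suc) (K ∘ suc)
  expand = trans (det-firstRowHead r (λ a b → cartan (J a) (K b)) row₀)
                 (trans (cong (_* cartanMinor r (J ∘ suc) (K ∘ suc)) (trans (cong (cartan (J zero)) K₀≡1+J₀) (cartan-up (J zero))))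
                        (-1*x≡-x _))
...   | no K₀≢1+J₀ = zero≡ (det-firstRowZero r (λ a b → cartan (J a) (K b)) λ b →
                       cartan-farRight (J zero) (K b) (ℕP.≤-trans (ℕP.≤∧≢⇒< J₀<K₀ (K₀≢1+J₀ ∘ sym)) (Increasing-head≤ K↑ b)))
ZeroOr±Divisor!-cartanMinor n r J K J↑ K↑ J<n | tri> _ _ K₀<J₀ with J zero ℕ.≟ suc (K zero)
...   | yes J₀≡1+K₀ = subst (ZeroOr±Divisor! _) (sym expand) (ZeroOr±Divisor!-neg (ZeroOr±Divisor!-cartanMinor-tail n r J K J↑ K↑ J<n))
  where
  col₀ : ∀ a → cartan (J (suc a)) (K zero) ≡ 0ℚ
  col₀ a = cartan-farLeft (J (suc a)) (K zero) (subst (_< J (suc a)) J₀≡1+K₀ (Increasing-head< J↑ a))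
  expand : cartanMinor (suc r) J K ≡ - cartanMinor r (J ∘ suc) (K ∘ suc)
  expand = trans (det-firstColHead r (λ a b → cartan (J a) (K b)) col₀)
                 (trans (cong (_* cartanMinor r (J ∘ suc) (K ∘ suc)) (trans (cong (λ j → cartan j (K zero)) J₀≡1+K₀) (cartan-down (K zero))))
                        (-1*x≡-x _))
...   | no J₀≢1+K₀ = zero≡ (det-zeroCol (suc r) (λ a b → cartan (J a) (K b)) zero λ a →
                       cartan-farLeft (J a) (K zero) (ℕP.≤-trans (ℕP.≤∧≢⇒< K₀<J₀ (J₀≢1+K₀ ∘ sym)) (Increasing-head≤ J↑ a)))

ZeroOr±Divisor!-cartanMinor-tail n zero    J K J↑ K↑ J<n = ZeroOr±Divisor!-one
ZeroOr±Divisor!-cartanMinor-tail n (suc r) J K J↑ K↑ J<n =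
  ZeroOr±Divisor!-mono (ℕP.∸-monoʳ-≤ (suc n) (ℕP.⊔-mono-≤ (ℕP.<⇒≤ (Increasing-head< J↑ zero)) (ℕP.<⇒≤ (Increasing-head< K↑ zero))))
                 (ZeroOr±Divisor!-cartanMinor n r (J ∘ suc) (K ∘ suc) (Increasing-tail J↑) (Increasing-tail K↑) (J<n ∘ suc))

ZeroOr±Divisor!-cartanMinor-diagonalRun n zero J K J↑ K↑ J<n J₀≡K₀ m =
  subst₂ ZeroOr±Divisor! (2+m+[n∸1+s]≡[n∸s]+1+m m (J<n zero)) value (ZeroOr±Divisor!-scale (suc m) ZeroOr±Divisor!-one)
  where
  shape : ∀ M → (1ℚ + (1ℚ + M)) * 1ℚ ≡ (1ℚ + M) * (1ℚ * ((1ℚ + (1ℚ + 0ℚ)) * 1ℚ) + 0ℚ) - M * 1ℚ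
  shape = solve-∀ ℚ-ring
  value : fromℕ (suc (suc m)) * 1ℚ ≡ fromℕ (suc m) * cartanMinor 1 J K - fromℕ m * 1ℚ
  value = trans (shape (fromℕ m))
                (cong (λ c → fromℕ (suc m) * (1ℚ * (c * 1ℚ) + 0ℚ) - fromℕ m * 1ℚ)
                      (sym (trans (cong (cartan (J zero)) (sym J₀≡K₀)) (cartan-diag (J zero)))))
ZeroOr±Divisor!-cartanMinor-diagonalRun n (suc r) J K J↑ K↑ J<n J₀≡K₀ m
  with cartanMinor-runContinues⊎ends r J K J↑ K↑ J₀≡K₀
... | inj₁ (J₁≡1+J₀ , K₁≡1+J₀) =
  subst₂ ZeroOr±Divisor! budget value
    (ZeroOr±Divisor!-cartanMinor-diagonalRun n r (J ∘ suc) (K ∘ suc) (Increasing-tail J↑) (Increasing-tail K↑) (J<n ∘ suc)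
                                             (trans J₁≡1+J₀ (sym K₁≡1+J₀)) (suc m))
  where
  D′ = cartanMinor (suc r) (J ∘ suc) (K ∘ suc)
  D″ = cartanMinor r (λ a → J (suc (suc a))) (λ b → K (suc (suc b)))
  budget : (n ∸ J (suc zero)) ℕ.+ suc (suc m) ≡ (n ∸ J zero) ℕ.+ suc m
  budget = trans (cong (λ j → (n ∸ j) ℕ.+ suc (suc m)) J₁≡1+J₀) ([n∸1+s]+2+m≡[n∸s]+1+m m (J<n zero))
  coupling≡1 : cartan (J zero) (K (suc zero)) * cartan (J (suc zero)) (K zero) ≡ 1ℚ
  coupling≡1 = cong₂ _*_ (trans (cong (cartan (J zero)) K₁≡1+J₀) (cartan-up (J zero)))
                         (trans (cong₂ cartan J₁≡1+J₀ (sym J₀≡K₀)) (cartan-down (J zero)))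
  shape : ∀ M x y → (1ℚ + (1ℚ + M)) * x - (1ℚ + M) * y ≡ (1ℚ + M) * ((1ℚ + (1ℚ + 0ℚ)) * x - 1ℚ * y) - M * x
  shape = solve-∀ ℚ-ring
  value : fromℕ (suc (suc m)) * D′ - fromℕ (suc m) * D″ ≡ fromℕ (suc m) * cartanMinor (suc (suc r)) J K - fromℕ m * D′
  value = trans (shape (fromℕ m) D′ D″)
                (cong (λ d → fromℕ (suc m) * d - fromℕ m * D′)
                      (sym (trans (cartanMinor-continuant r J K J↑ K↑ J₀≡K₀) (cong (λ c → fromℕ 2 * D′ - c * D″) coupling≡1))))
... | inj₂ (coupling≡0 , 2+J₀≤J₁⊔K₁) =
  subst₂ ZeroOr±Divisor! (2+m+[n∸1+s]≡[n∸s]+1+m m (J<n zero)) value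
    (ZeroOr±Divisor!-scale (suc m) (ZeroOr±Divisor!-mono (ℕP.∸-monoʳ-≤ (suc n) 2+J₀≤J₁⊔K₁)
      (ZeroOr±Divisor!-cartanMinor n r (J ∘ suc) (K ∘ suc) (Increasing-tail J↑) (Increasing-tail K↑) (J<n ∘ suc))))
  where
  D′ = cartanMinor (suc r) (J ∘ suc) (K ∘ suc)
  D″ = cartanMinor r (λ a → J (suc (suc a))) (λ b → K (suc (suc b)))
  shape : ∀ M x y → (1ℚ + (1ℚ + M)) * x ≡ (1ℚ + M) * ((1ℚ + (1ℚ + 0ℚ)) * x - 0ℚ * y) - M * x
  shape = solve-∀ ℚ-ring
  value : fromℕ (suc (suc m)) * D′ ≡ fromℕ (suc m) * cartanMinor (suc (suc r)) J K - fromℕ m * D′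
  value = trans (shape (fromℕ m) D′ D″)
                (cong (λ d → fromℕ (suc m) * d - fromℕ m * D′)
                      (sym (trans (cartanMinor-continuant r J K J↑ K↑ J₀≡K₀) (cong (λ c → fromℕ 2 * D′ - c * D″) coupling≡0))))

-- Minors of [I ; A]

kronecker : ℕ → ℕ → ℚ
kronecker s t with s ℕ.≟ t
... | yes _ = 1ℚ
... | no  _ = 0ℚ

kronecker-diag : ∀ s → kronecker s s ≡ 1ℚ
kronecker-diag s with s ℕ.≟ s
... | yes _   = refl
... | no  s≢s = ⊥-elim (s≢s refl)

kronecker-≢ : ∀ {s t} → s ≢ t → kronecker s t ≡ 0ℚ
kronecker-≢ {s} {t} s≢t with s ℕ.≟ t
... | yes s≡t = ⊥-elim (s≢t s≡t)
... | no  _   = refl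

identity-toℕ : ∀ n (i j : Fin n) → identity n i j ≡ kronecker (toℕ i) (toℕ j)
identity-toℕ n i j with i Fin.≟ j
... | yes refl = sym (kronecker-diag (toℕ i))
... | no  i≢j  = sym (kronecker-≢ (i≢j ∘ FinP.toℕ-injective))

identityOverCartan : ℕ → ℕ → ℕ → ℚ
identityOverCartan n t k with t ℕ.<? n
... | yes _ = kronecker t k
... | no  _ = cartan (t ∸ n) k

identityOverCartan-< : ∀ {n t} k → t < n → identityOverCartan n t k ≡ kronecker t k
identityOverCartan-< {n} {t} k t<n with t ℕ.<? n
... | yes _   = refl
... | no  t≮n = ⊥-elim (t≮n t<n)

identityOverCartan-≮ : ∀ {n t} k → ¬ t < n → identityOverCartan n t k ≡ cartan (t ∸ n) k
identityOverCartan-≮ {n} {t} k t≮n with t ℕ.<? n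
... | yes t<n = ⊥-elim (t≮n t<n)
... | no  _   = refl

stack·cartanA : ∀ n (Ainv : Mat n n) → Ainv · cartanA n ≡ identity n →
                ∀ t c → (stack Ainv (identity n) · cartanA n) t c ≡ identityOverCartan n (toℕ t) (toℕ c)
stack·cartanA n Ainv Ainv·A≡I t c with splitAt n t in eq
... | inj₁ i = begin
  (Ainv · cartanA n) i c                                   ≡⟨ cong (λ M → M i c) Ainv·A≡I ⟩
  identity n i c                                           ≡⟨ identity-toℕ n i c ⟩
  kronecker (toℕ i) (toℕ c)                                ≡⟨ cong (λ s → kronecker s (toℕ c)) (sym t≡i) ⟩
  kronecker (toℕ t) (toℕ c)                                ≡⟨ sym (identityOverCartan-< (toℕ c) (subst (_< n) (sym t≡i) (FinP.toℕ<n i))) ⟩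
  identityOverCartan n (toℕ t) (toℕ c)                     ∎
  where
  open ≡-Reasoning
  t≡i : toℕ t ≡ toℕ i
  t≡i = trans (cong toℕ (sym (FinP.splitAt⁻¹-↑ˡ eq))) (FinP.toℕ-↑ˡ i n)
... | inj₂ i = begin
  Σᶠ n (λ j → identity n i j * cartanA n j c)              ≡⟨ Σᶠ-single n _ i off-diagonal ⟩
  identity n i i * cartanA n i c                           ≡⟨ cong (_* cartanA n i c) (trans (identity-toℕ n i i) (kronecker-diag (toℕ i))) ⟩
  1ℚ * cartanA n i c                                       ≡⟨ ℚP.*-identityˡ _ ⟩
  cartanA n i c                                            ≡⟨ cartanA-toℕ n i c ⟩
  cartan (toℕ i) (toℕ c)                                   ≡⟨ cong (λ s → cartan s (toℕ c)) (sym t∸n≡i) ⟩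
  cartan (toℕ t ∸ n) (toℕ c)                               ≡⟨ sym (identityOverCartan-≮ (toℕ c) t≮n) ⟩
  identityOverCartan n (toℕ t) (toℕ c)                     ∎
  where
  open ≡-Reasoning
  t≡n+i : toℕ t ≡ n ℕ.+ toℕ i
  t≡n+i = trans (cong toℕ (sym (FinP.splitAt⁻¹-↑ʳ eq))) (FinP.toℕ-↑ʳ n i)
  t∸n≡i : toℕ t ∸ n ≡ toℕ i
  t∸n≡i = trans (cong (_∸ n) t≡n+i) (ℕP.m+n∸m≡n n (toℕ i))
  t≮n : ¬ toℕ t < n
  t≮n t<n = ℕP.<⇒≱ t<n (subst (n ≤_) (sym t≡n+i) (ℕP.m≤m+n n (toℕ i)))
  off-diagonal : ∀ j → j ≢ i → identity n i j * cartanA n j c ≡ 0ℚ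
  off-diagonal j j≢i = trans (cong (_* cartanA n j c) (trans (identity-toℕ n i j) (kronecker-≢ (j≢i ∘ sym ∘ FinP.toℕ-injective))))
                             (ℚP.*-zeroˡ (cartanA n j c))

ZeroOr±Divisor!-identityOverCartanMinor :
  ∀ n r (F K : Fin r → ℕ) → Increasing F → Increasing K → (∀ a → F a < n ℕ.+ n) →
  ZeroOr±Divisor! (suc n) (det r (λ a b → identityOverCartan n (F a) (K b)))
ZeroOr±Divisor!-identityOverCartanMinor n zero    F K _  _  _    = ZeroOr±Divisor!-one
ZeroOr±Divisor!-identityOverCartanMinor n (suc r) F K F↑ K↑ F<2n = by-first-row (F zero ℕ.<? n)
  where
  M : Mat (suc r) (suc r)
  M a b = identityOverCartan n (F a) (K b)

  identity-row : F zero < n → Dec (∃ λ b → K b ≡ F zero) → ZeroOr±Divisor! (suc n) (det (suc r) M)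
  identity-row F₀<n (yes (b₀ , Kb₀≡F₀)) =
    subst (ZeroOr±Divisor! (suc n)) (sym expand)
      (ZeroOr±Divisor!-sgn (toℕ b₀) (subst (ZeroOr±Divisor! (suc n)) (sym (ℚP.*-identityˡ _))
        (ZeroOr±Divisor!-identityOverCartanMinor n r (F ∘ suc) (K ∘ punchIn b₀)
          (Increasing-tail F↑) (Increasing-punchIn K↑ b₀) (F<2n ∘ suc))))
    where
    row₀ : ∀ b → b ≢ b₀ → M zero b ≡ 0ℚ
    row₀ b b≢b₀ = trans (identityOverCartan-< (K b) F₀<n)
                        (kronecker-≢ λ F₀≡Kb → Increasing-injective K↑ b b₀ b≢b₀ (trans (sym F₀≡Kb) (sym Kb₀≡F₀)))
    expand : det (suc r) M ≡ sgn (toℕ b₀) * (1ℚ * det r (minorAt M b₀))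
    expand = trans (det-firstRowSingle r M b₀ row₀)
                   (cong (λ x → sgn (toℕ b₀) * (x * det r (minorAt M b₀)))
                         (trans (identityOverCartan-< (K b₀) F₀<n) (trans (cong (kronecker (F zero)) Kb₀≡F₀) (kronecker-diag (F zero)))))
  identity-row F₀<n (no ∄b) = zero≡ (det-firstRowZero r M λ b →
    trans (identityOverCartan-< (K b) F₀<n) (kronecker-≢ λ F₀≡Kb → ∄b (b , sym F₀≡Kb)))

  by-first-row : Dec (F zero < n) → ZeroOr±Divisor! (suc n) (det (suc r) M)
  by-first-row (yes F₀<n) = identity-row F₀<n (FinP.any? (λ b → K b ℕ.≟ F zero))
  by-first-row (no F₀≮n)  =
    ZeroOr±Divisor!-mono (ℕP.m∸n≤m (suc n) (J zero ⊔ K zero))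
      (subst (ZeroOr±Divisor! _) (det-cong (suc r) λ a b → sym (identityOverCartan-≮ (K b) (ℕP.≤⇒≯ (n≤F a))))
        (ZeroOr±Divisor!-cartanMinor n r J K J↑ K↑ J<n))
    where
    n≤F : ∀ a → n ≤ F a
    n≤F a = ℕP.≤-trans (ℕP.≮⇒≥ F₀≮n) (Increasing-head≤ F↑ a)
    J : Fin (suc r) → ℕ
    J a = F a ∸ n
    J↑ : Increasing J
    J↑ a b a<b = ℕP.∸-monoˡ-< (F↑ a b a<b) (n≤F a)
    J<n : ∀ a → J a < n
    J<n a = subst (J a <_) (ℕP.m+n∸n≡m n n) (ℕP.∸-monoˡ-< (F<2n a) (n≤F a))

ZeroOr±Divisor!-scaled⇒fraction : ∀ B d q → ZeroOr±Divisor! B (fromℕ (suc d) * q) →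
                                  q ≡ 0ℚ ⊎ ∃ λ (k : ℤ) → k ∣ + (B !) × q ≡ k / suc d
ZeroOr±Divisor!-scaled⇒fraction B d q (zero≡ dq≡0) =
  inj₁ (fromℕ-cancelˡ (suc d) (trans dq≡0 (sym (ℚP.*-zeroʳ (fromℕ (suc d))))))
ZeroOr±Divisor!-scaled⇒fraction B d q (+∣!≡ P P∣B! dq≡P) =
  inj₂ (+ P , P∣B! , fromℕ-cancelˡ (suc d) (trans dq≡P (sym (fromℕ-*-/ d P))))
ZeroOr±Divisor!-scaled⇒fraction B d q (-∣!≡ zero    _ dq≡-0) =
  inj₁ (fromℕ-cancelˡ (suc d) (trans dq≡-0 (sym (ℚP.*-zeroʳ (fromℕ (suc d))))))
ZeroOr±Divisor!-scaled⇒fraction B d q (-∣!≡ (suc p) P∣B! dq≡-P) =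
  inj₂ (-[1+ p ] , P∣B! , fromℕ-cancelˡ (suc d) (trans dq≡-P (sym (begin
    fromℕ (suc d) * (- ((+ suc p) / suc d))   ≡⟨ x*-y≡-[x*y] (fromℕ (suc d)) _ ⟩
    - (fromℕ (suc d) * ((+ suc p) / suc d))   ≡⟨ cong -_ (fromℕ-*-/ d (suc p)) ⟩
    - fromℕ (suc p)                           ∎))))
  where
  open ≡-Reasoning

lemma5p3 : (n : ℕ) → 1 ≤ n → (Ainv : Mat n n) → IsInverse (cartanA n) Ainv →
    (S : RowChoice n (n ℕ.+ n)) →
      minor (stack Ainv (identity n)) S ≡ 0ℚ
      ⊎ ∃ (λ (k : ℤ) → (k ∣ (+ ((suc n) !))) × (minor (stack Ainv (identity n)) S ≡ k / suc n))
lemma5p3 n _ Ainv (_ , Ainv·A≡I) S@(f , f↑) =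
  ZeroOr±Divisor!-scaled⇒fraction (suc n) n (minor M S) (subst (ZeroOr±Divisor! (suc n)) scaled minor-of-I/A)
  where
  M = stack Ainv (identity n)
  minor-of-I/A : ZeroOr±Divisor! (suc n) (det n (λ a b → identityOverCartan n (toℕ (f a)) (toℕ b)))
  minor-of-I/A = ZeroOr±Divisor!-identityOverCartanMinor n n (toℕ ∘ f) toℕ f↑ (λ _ _ a<b → a<b) (FinP.toℕ<n ∘ f)
  scaled : det n (λ a b → identityOverCartan n (toℕ (f a)) (toℕ b)) ≡ fromℕ (suc n) * minor M S
  scaled = trans (det-cong n λ a b → sym (stack·cartanA n Ainv Ainv·A≡I (f a) b))
                 (det-·-cartanA n (λ a b → M (f a) b))
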